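{- Let $G$ be a DAG with $n$ inputs and $n$ outputs that is maximally ST-robust with depth $d$. Then $G$ is $(n-1,d)$-source-to-sink-depth-robust.
   Context: For a DAG $G$ with a set $I$ of $n$ inputs and a set $O$ of $n$ outputs, $G$ is $(k_1,k_2,d)$-ST-robust if for every $D\subseteq V(G)$ with $|D|\le k_1$ there is a subgraph $H$ of $G-D$ with $|I\cap V(H)|\ge k_2$, $|O\cap V(H)|\ge k_2$, such that for every $s\in I\cap V(H)$ and $t\in O\cap V(H)$ there is a directed path from $s$ to $t$ in $H$ of length at least $d$; $G$ is maximally ST-robust with depth $d$ if it is $(k,n-k,d)$-ST-robust for all $0\le k\le n$. A DAG $G=(V,E)$ is $(e,d)$-source-to-sink-depth-robust if for every $S\subseteq V$ with $|S|\le e$, $G-S$ has a path of length at least $d$ that starts at a source node of $G$ and ends at a sink node of $G$ (here the inputs are the sources and the outputs are the sinks). -}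

module Defs where

open import Data.Nat using (ℕ; zero; suc; _≤_; _∸_)
open import Data.Fin using (Fin)
open import Data.Fin.Subset using (Subset; _∈_; _∉_; _∩_; ∣_∣)
open import Data.Product using (Σ; ∃; _×_; _,_)
open import Data.Unit using (⊤)
open import Data.Empty using (⊥)
open import Relation.Nullary using (¬_)
open import Level using (0ℓ)

record Graph (N : ℕ) : Set₁ where
  field
    Edge : Fin N → Fin N → Set

open Graph public

data Path {N : ℕ} (P : Fin N → Set) (R : Fin N → Fin N → Set)
          : Fin N → Fin N → ℕ → Set where
  [] : ∀ {v} → P v → Path P R v v 0
  _∷_ : ∀ {u v w ℓ} → P u → R u v → Path P R v w ℓ → Path P R u w (suc ℓ)

IsDAG : ∀ {N} → Graph N → Set
IsDAG {N} G = ∀ (v : Fin N) (ℓ : ℕ) → ¬ Path (λ _ → ⊤) (Edge G) v v (suc ℓ)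

IsSource : ∀ {N} → Graph N → Fin N → Set
IsSource {N} G v = ¬ (Σ (Fin N) λ u → Edge G u v)

IsSink : ∀ {N} → Graph N → Fin N → Set
IsSink {N} G v = ¬ (Σ (Fin N) λ w → Edge G v w)

record SubgraphAvoiding {N : ℕ} (G : Graph N) (D : Subset N) : Set₁ where
  field
    HV : Subset N
    HE : Fin N → Fin N → Set
    HV-avoids : ∀ v → v ∈ HV → v ∉ D
    HE-sub    : ∀ u v → HE u v → Edge G u v × u ∈ HV × v ∈ HV

open SubgraphAvoiding public

STRobust : ∀ {N} → Graph N → (I O : Subset N) → (k₁ k₂ d : ℕ) → Set₁
STRobust {N} G I O k₁ k₂ d =
  ∀ (D : Subset N) → ∣ D ∣ ≤ k₁ →
  Σ (SubgraphAvoiding G D) λ H →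
    k₂ ≤ ∣ I ∩ HV H ∣ × k₂ ≤ ∣ O ∩ HV H ∣ ×
    (∀ s t → s ∈ I → s ∈ HV H → t ∈ O → t ∈ HV H →
       Σ ℕ λ ℓ → d ≤ ℓ × Path (λ v → v ∈ HV H) (HE H) s t ℓ)

MaxSTRobust : ∀ {N} → Graph N → (I O : Subset N) → (n d : ℕ) → Set₁
MaxSTRobust G I O n d = ∀ k → k ≤ n → STRobust G I O k (n ∸ k) d

SourceToSinkDepthRobust : ∀ {N} → Graph N → (e d : ℕ) → Set
SourceToSinkDepthRobust {N} G e d =
  ∀ (S : Subset N) → ∣ S ∣ ≤ e →
  Σ (Fin N) λ s → Σ (Fin N) λ t → Σ ℕ λ ℓ →
    IsSource G s × IsSink G t × d ≤ ℓ ×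
    Path (λ v → v ∉ S) (Edge G) s t ℓ

module Submission where

open import Defs
open import Data.Nat using (ℕ; _≤_; _<_; _∸_; z<s)
open import Data.Nat.Properties using (m∸[m∸n]≡n; m∸n≤m; >⇒≢; <-≤-trans)
open import Data.Fin using (Fin)
open import Data.Fin.Subset using (Subset; _∈_; _∉_; ∣_∣; Nonempty; _∩_)
open import Data.Fin.Subset.Properties using (nonempty?; Empty-unique; ∣⊥∣≡0; x∈p∩q⁻)
open import Data.Product using (Σ; _×_; _,_; proj₁)
open import Function.Bundles using (_⇔_; Equivalence)
open import Relation.Binary.PropositionalEquality using (_≡_; cong; trans; sym; subst)
open import Relation.Nullary using (yes; no; contradiction)

-- Removing n - 1 vertices from a maximally ST-robust DAG still leaves a subgraph
-- containing an input and an output joined by a path of length at least d.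
-- Inputs and outputs are exactly the sources and sinks, so that path witnesses
-- source-to-sink depth-robustness.

∣p∣>0⇒Nonempty : ∀ {N} (p : Subset N) → 0 < ∣ p ∣ → Nonempty p
∣p∣>0⇒Nonempty {N} p 0<∣p∣ with nonempty? p
... | yes p≠∅ = p≠∅
... | no  p=∅ = contradiction (trans (cong ∣_∣ (Empty-unique p=∅)) (∣⊥∣≡0 N)) (>⇒≢ 0<∣p∣)

Path-map : ∀ {N} {P P′ : Fin N → Set} {R R′ : Fin N → Fin N → Set} →
  (∀ v → P v → P′ v) → (∀ u v → R u v → R′ u v) →
  ∀ {s t ℓ} → Path P R s t ℓ → Path P′ R′ s t ℓ
Path-map f g ([] pv)              = [] (f _ pv)
Path-map f g (_∷_ {u} {v} pu e p) = _∷_ (f u pu) (g u v e) (Path-map f g p)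

SubgraphAvoiding-path : ∀ {N} {G : Graph N} {D : Subset N} (H : SubgraphAvoiding G D) →
  ∀ {s t ℓ} → Path (_∈ HV H) (HE H) s t ℓ → Path (_∉ D) (Edge G) s t ℓ
SubgraphAvoiding-path H = Path-map (HV-avoids H) (λ u v e → proj₁ (HE-sub H u v e))

STRobust⇒long-path-avoiding : ∀ {N} {G : Graph N} {I O : Subset N} {k₁ k₂ d : ℕ} →
  STRobust G I O k₁ k₂ d → 0 < k₂ →
  ∀ (D : Subset N) → ∣ D ∣ ≤ k₁ →
  Σ (Fin N) λ s → Σ (Fin N) λ t → Σ ℕ λ ℓ →
    s ∈ I × t ∈ O × d ≤ ℓ × Path (_∉ D) (Edge G) s t ℓ
STRobust⇒long-path-avoiding {I = I} {O} robust 0<k₂ D ∣D∣≤k₁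
  with robust D ∣D∣≤k₁
... | H , k₂≤∣I∩H∣ , k₂≤∣O∩H∣ , paths
  with ∣p∣>0⇒Nonempty (I ∩ HV H) (<-≤-trans 0<k₂ k₂≤∣I∩H∣)
     | ∣p∣>0⇒Nonempty (O ∩ HV H) (<-≤-trans 0<k₂ k₂≤∣O∩H∣)
... | s , s∈I∩H | t , t∈O∩H
  with x∈p∩q⁻ I (HV H) s∈I∩H | x∈p∩q⁻ O (HV H) t∈O∩H
... | s∈I , s∈H | t∈O , t∈H
  with paths s t s∈I s∈H t∈O t∈H
... | ℓ , d≤ℓ , path = s , t , ℓ , s∈I , t∈O , d≤ℓ , SubgraphAvoiding-path H path

theorem7 : ∀ {N : ℕ} (G : Graph N) (I O : Subset N) (n d : ℕ) →
    IsDAG G →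
    1 ≤ n →
    ∣ I ∣ ≡ n → ∣ O ∣ ≡ n →
    (∀ v → (v ∈ I) ⇔ IsSource G v) →
    (∀ v → (v ∈ O) ⇔ IsSink G v) →
    MaxSTRobust G I O n d →
    SourceToSinkDepthRobust G (n ∸ 1) d
theorem7 G I O n d _ 1≤n _ _ I⇔sources O⇔sinks maxRobust S ∣S∣≤n-1
  with STRobust⇒long-path-avoiding (maxRobust (n ∸ 1) (m∸n≤m n 1)) one-survivor S ∣S∣≤n-1
  where
    one-survivor : 0 < n ∸ (n ∸ 1)
    one-survivor = subst (0 <_) (sym (m∸[m∸n]≡n 1≤n)) z<s
... | s , t , ℓ , s∈I , t∈O , d≤ℓ , path =
  s , t , ℓ , Equivalence.to (I⇔sources s) s∈I , Equivalence.to (O⇔sinks t) t∈O , d≤ℓ , path
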